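{- Let $G$ be a finite simple graph, $S$ a dominating set of $G$, and $\mathcal D$ a $(2k+1,k)$-configuration of $G$. Then the multiset consisting of $S$ together with two copies of every element of $\mathcal D$ is a $(2r+1,r)$-configuration of $G$, where $r=2k+1$.
   Context: A set is dominating if every vertex outside it has a neighbour in it. A $(k,s)$-configuration of a graph is a multiset of $k$ (not necessarily distinct) dominating sets such that every vertex lies in at most $s$ of them. -}

module Defs where

open import Data.Nat using (ℕ; _≤_; _+_; _*_)
open import Data.Fin using (Fin)
open import Data.Fin.Subset using (Subset; _∈_; _∉_)
open import Data.Fin.Subset.Properties using (_∈?_)
open import Data.List using (List; []; _∷_; length; filter; concatMap)
open import Data.List.Relation.Unary.All using (All)
open import Data.Product using (∃; _×_)
open import Relation.Nullary using (¬_)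

record SimpleGraph (n : ℕ) : Set₁ where
  field
    Adj       : Fin n → Fin n → Set
    sym       : ∀ {u v} → Adj u v → Adj v u
    irrefl    : ∀ {v} → ¬ Adj v v

open SimpleGraph public

IsDominating : ∀ {n} → SimpleGraph n → Subset n → Set
IsDominating {n} G S = ∀ (v : Fin n) → v ∉ S → ∃ λ (u : Fin n) → u ∈ S × Adj G v u

multiplicity : ∀ {n} → Fin n → List (Subset n) → ℕ
multiplicity v D = length (filter (v ∈?_) D)

IsConfiguration : ∀ {n} → SimpleGraph n → ℕ → ℕ → List (Subset n) → Set
IsConfiguration {n} G k s D =
  length D ≡ k × All (IsDominating G) D × (∀ (v : Fin n) → multiplicity v D ≤ s)
  where open import Relation.Binary.PropositionalEquality using (_≡_)

extendConfig : ∀ {n} → Subset n → List (Subset n) → List (Subset n)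
extendConfig S D = S ∷ concatMap (λ X → X ∷ X ∷ []) D

-- Doubling a multiset of dominating sets doubles its size and every multiplicity, and adding the
-- dominating set S raises each by at most one; so S with two copies of an (m, s)-configuration is a
-- (2m + 1, 2s + 1)-configuration, and m = 2k + 1, s = k is the claim.
module Submission where

open import Defs hiding (sym)
open import Data.Bool using (true; false)
open import Data.Nat using (ℕ; suc; _+_; _*_; _≤_; s≤s)
open import Data.Nat.Properties using (*-suc; +-comm; ≤-refl; n≤1+n; ≤-trans; *-monoʳ-≤)
open import Data.Fin.Subset using (Subset)
open import Data.Fin.Subset.Properties using (_∈?_)
open import Data.List using (List; []; _∷_; length; filter; concatMap)
open import Data.List.Properties using (filter-accept; filter-reject)
open import Data.List.Relation.Unary.All using (All; []; _∷_)
open import Data.Product using (_,_)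
open import Level using (Level)
open import Relation.Nullary using (Dec; does; yes; no)
open import Relation.Unary using (Pred; Decidable)
open import Relation.Binary.PropositionalEquality using (_≡_; refl; cong; sym; trans; subst; subst₂; module ≡-Reasoning)

private
  variable
    a p : Level
    A : Set a

duplicate : List A → List A
duplicate = concatMap (λ x → x ∷ x ∷ [])

length-duplicate : (xs : List A) → length (duplicate xs) ≡ 2 * length xs
length-duplicate []       = refl
length-duplicate (x ∷ xs) = trans (cong (2 +_) (length-duplicate xs)) (sym (*-suc 2 (length xs)))

filter-duplicate : {P : Pred A p} (P? : Decidable P) (xs : List A) →
                   filter P? (duplicate xs) ≡ duplicate (filter P? xs)
filter-duplicate P? []       = refl
filter-duplicate {P = P} P? (x ∷ xs) = by-cases (P? x)
  where
  open ≡-Reasoning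

  by-cases : Dec (P x) → filter P? (x ∷ x ∷ duplicate xs) ≡ duplicate (filter P? (x ∷ xs))
  by-cases (yes px) = begin
    filter P? (x ∷ x ∷ duplicate xs)   ≡⟨ filter-accept P? px ⟩
    x ∷ filter P? (x ∷ duplicate xs)   ≡⟨ cong (x ∷_) (filter-accept P? px) ⟩
    x ∷ x ∷ filter P? (duplicate xs)   ≡⟨ cong (λ ys → x ∷ x ∷ ys) (filter-duplicate P? xs) ⟩
    duplicate (x ∷ filter P? xs)       ≡⟨ cong duplicate (filter-accept P? px) ⟨
    duplicate (filter P? (x ∷ xs))     ∎
  by-cases (no ¬px) = begin
    filter P? (x ∷ x ∷ duplicate xs)   ≡⟨ filter-reject P? ¬px ⟩
    filter P? (x ∷ duplicate xs)       ≡⟨ filter-reject P? ¬px ⟩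
    filter P? (duplicate xs)           ≡⟨ filter-duplicate P? xs ⟩
    duplicate (filter P? xs)           ≡⟨ cong duplicate (filter-reject P? ¬px) ⟨
    duplicate (filter P? (x ∷ xs))     ∎

length-filter-duplicate : {P : Pred A p} (P? : Decidable P) (xs : List A) →
                          length (filter P? (duplicate xs)) ≡ 2 * length (filter P? xs)
length-filter-duplicate P? xs =
  trans (cong length (filter-duplicate P? xs)) (length-duplicate (filter P? xs))

length-filter-∷-≤ : {P : Pred A p} (P? : Decidable P) (x : A) (xs : List A) →
                    length (filter P? (x ∷ xs)) ≤ suc (length (filter P? xs))
length-filter-∷-≤ P? x xs with does (P? x)
... | false = n≤1+n _
... | true  = ≤-refl

All-duplicate : {P : Pred A p} {xs : List A} → All P xs → All P (duplicate xs)
All-duplicate []       = []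
All-duplicate (p ∷ ps) = p ∷ p ∷ All-duplicate ps

extendConfig-isConfiguration : ∀ {n} (G : SimpleGraph n) {S : Subset n} {m s : ℕ} {D : List (Subset n)} →
                               IsDominating G S → IsConfiguration G m s D →
                               IsConfiguration G (suc (2 * m)) (suc (2 * s)) (extendConfig S D)
extendConfig-isConfiguration G {S} {D = D} domS (len , domD , mult) =
  cong suc (trans (length-duplicate D) (cong (2 *_) len)) ,
  domS ∷ All-duplicate domD ,
  λ v → ≤-trans (length-filter-∷-≤ (v ∈?_) S (duplicate D))
          (s≤s (subst (_≤ _) (sym (length-filter-duplicate (v ∈?_) D)) (*-monoʳ-≤ 2 (mult v))))

mainTheorem11 : ∀ {n : ℕ} (G : SimpleGraph n) (S : Subset n) (k : ℕ) (D : List (Subset n))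
                → IsDominating G S
                → IsConfiguration G (2 * k + 1) k D
                → IsConfiguration G (2 * (2 * k + 1) + 1) (2 * k + 1) (extendConfig S D)
mainTheorem11 G S k D domS config =
  subst₂ (λ m s → IsConfiguration G m s (extendConfig S D))
         (+-comm 1 (2 * (2 * k + 1))) (+-comm 1 (2 * k))
         (extendConfig-isConfiguration G domS config)
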